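{- Let $q$ be an odd prime power, $d$ a positive integer, $\varphi_d$ the coloring defined in the context, and $p \geq 1$. If $S \subseteq (\mathbb{F}_q^*)^d$ is a set of $p$ vectors with a leftover structure under $\varphi_d$, then $\mathrm{FS}(S) \geq \lceil \log_2 p \rceil + 1$.
   Context: $\mathbb{F}_q^*$ is the set of nonzero elements of $\mathbb{F}_q$, with an arbitrary fixed linear order; $(\mathbb{F}_q^*)^d$ is ordered lexicographically. $C_d = \mathrm{DOT} \sqcup \mathrm{ZERO} \sqcup \mathrm{UP} \sqcup \mathrm{DOWN}$, with $\mathrm{DOT} = \mathbb{F}_q^*$ and ZERO, UP, DOWN disjoint copies of $\{1,\ldots,d\}\times\mathbb{F}_q$. For distinct $x<y$, with $i$ the first coordinate where they differ and $\cdot$ the standard dot product, $\varphi_d(x,y)=\varphi_d(y,x)$ equals $(i,x_i+y_i)_{\mathrm{ZERO}}$ if $x\cdot y=0$; $(i,x_i+y_i)_{\mathrm{UP}}$ if $x\cdot y\neq 0$ and $x\cdot y = x\cdot x$; $(i,x_i+y_i)_{\mathrm{DOWN}}$ if $x\cdot y\notin\{0,x\cdot x\}$ and $x\cdot y = y\cdot y$; and $x\cdot y\in\mathrm{DOT}$ otherwise. For a vertex set $X$, $\varphi_d(X)$ is the set of colors on pairs inside $X$. $S$ has a leftover structure under $\varphi_d$ if $|S|=1$ or there is a partition $S = A\cup B$ into nonempty sets with $A$, $B$ each having a leftover structure, $\varphi_d(A)\cap\varphi_d(B)=\emptyset$, and a color $\gamma$ with $\varphi_d(a,b)=\gamma$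 for all $a\in A, b\in B$ and $\gamma\notin\varphi_d(A)\cup\varphi_d(B)$. A set of distinct vectors $\{s_1,\ldots,s_t\}$ is a $t$-falling star under $\varphi_d$ if there are colors $\alpha_2,\ldots,\alpha_t$ with $\varphi_d(s_i,s_j)=\alpha_i$ for all $1\leq j<i\leq t$; $\mathrm{FS}(S)$ is the maximum $t$ such that $S$ contains a $t$-falling star. -}

module Defs where

open import Level using (0ℓ)
open import Data.Nat using (ℕ; zero; suc; _≤_; _<_)
open import Data.Nat.Logarithm using (⌈log₂_⌉)
open import Data.Fin using (Fin) renaming (zero to fz; suc to fs)
import Data.Fin as Fin
open import Data.Vec using (Vec; []; _∷_; lookup)
open import Data.List using (List; []; _∷_; _++_; length)
open import Data.List.Membership.Propositional using (_∈_)
open import Data.List.Relation.Unary.All using (All)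
open import Data.List.Relation.Unary.Unique.Propositional using (Unique)
open import Data.List.Relation.Binary.Permutation.Propositional using (_↭_)
open import Data.Maybe using (Maybe; just; nothing)
open import Data.Product using (Σ; ∃; _×_; _,_)
open import Data.Empty using (⊥)
open import Relation.Nullary using (¬_; yes; no)
open import Relation.Binary.PropositionalEquality using (_≡_; _≢_)
open import Relation.Binary using (Rel; IsStrictTotalOrder; tri<; tri≈; tri>)
open import Algebra.Structures using (IsCommutativeRing)
open import Function.Bundles using (_↔_)

-- A finite field F_q, with an arbitrary fixed strict linear order on
-- its elements (used only on nonzero elements).

record FiniteField : Set₁ where
  infixl 6 _+_
  infixl 7 _*_
  infix  4 _<F_
  field
    Carrier  : Set
    _+_ _*_  : Carrier → Carrier → Carrier
    -_       : Carrier → Carrier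
    0# 1#    : Carrier
    isCommutativeRing : IsCommutativeRing _≡_ _+_ _*_ -_ 0# 1#
    0≢1      : 0# ≢ 1#
    inverse  : ∀ x → x ≢ 0# → ∃ λ y → x * y ≡ 1#
    q        : ℕ
    enum     : Carrier ↔ Fin q
    _<F_     : Rel Carrier 0ℓ
    isSTO    : IsStrictTotalOrder _≡_ _<F_

module WithField (𝔽 : FiniteField) (d : ℕ) where
  open FiniteField 𝔽

  _≟F_ = IsStrictTotalOrder._≟_ isSTO

  V : Set
  V = Vec Carrier d

  Nonzero : V → Set
  Nonzero x = ∀ i → lookup x i ≢ 0#

  dotp : ∀ {n} → Vec Carrier n → Vec Carrier n → Carrier
  dotp []       []       = 0#
  dotp (a ∷ xs) (b ∷ ys) = a * b + dotp xs ys

  firstDiff : ∀ {n} → Vec Carrier n → Vec Carrier n → Maybe (Fin n)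
  firstDiff []       []       = nothing
  firstDiff (a ∷ xs) (b ∷ ys) with a ≟F b
  ... | no  _ = just fz
  ... | yes _ with firstDiff xs ys
  ...   | nothing = nothing
  ...   | just i  = just (fs i)

  data Colour : Set where
    DOT  : Carrier → Colour
    ZERO : Fin d → Carrier → Colour
    UP   : Fin d → Carrier → Colour
    DOWN : Fin d → Carrier → Colour

  -- colour of the pair (x , y) where x < y lexicographically,
  -- i the first differing coordinate
  colourOrdered : Fin d → V → V → Colour
  colourOrdered i x y with dotp x y ≟F 0#
  ... | yes _ = ZERO i (lookup x i + lookup y i)
  ... | no  _ with dotp x y ≟F dotp x x
  ...   | yes _ = UP i (lookup x i + lookup y i)
  ...   | no  _ with dotp x y ≟F dotp y y
  ...     | yes _ = DOWN i (lookup x i + lookup y i)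
  ...     | no  _ = DOT (dotp x y)

  -- φ_d (symmetric; value on x ≡ y is irrelevant and fixed arbitrarily)
  φ : V → V → Colour
  φ x y with firstDiff x y
  ... | nothing = DOT 1#
  ... | just i with IsStrictTotalOrder.compare isSTO (lookup x i) (lookup y i)
  ...   | tri< _ _ _ = colourOrdered i x y
  ...   | tri≈ _ _ _ = DOT 1#
  ...   | tri> _ _ _ = colourOrdered i y x

  _∈φ_ : Colour → List V → Set
  γ ∈φ X = ∃ λ a → ∃ λ b → a ∈ X × b ∈ X × a ≢ b × φ a b ≡ γ

  -- leftover structure (sets represented by duplicate-free lists;
  -- S = A ∪ B partition rendered as S ↭ A ++ B)
  data Leftover : List V → Set where
    single : ∀ x → Leftover (x ∷ [])
    split  : ∀ {S} (A B : List V) →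
             S ↭ A ++ B →
             A ≢ [] → B ≢ [] →
             Leftover A → Leftover B →
             (∀ γ → γ ∈φ A → γ ∈φ B → ⊥) →
             (γ : Colour) →
             (∀ a b → a ∈ A → b ∈ B → φ a b ≡ γ) →
             ¬ (γ ∈φ A) → ¬ (γ ∈φ B) →
             Leftover S

  HasFallingStar : List V → ℕ → Set
  HasFallingStar S t =
    Σ (Fin t → V) λ s →
      (∀ i j → s i ≡ s j → i ≡ j) ×
      (∀ i → s i ∈ S) ×
      Σ (Fin t → Colour) λ α →
        ∀ i j → j Fin.< i → φ (s i) (s j) ≡ α i

  FS≥ : List V → ℕ → Set
  FS≥ S k = ∃ λ t → k ≤ t × HasFallingStar S t

{-# OPTIONS --safe #-}
module Submission where

-- If S = A ∪ B with every cross pair coloured γ,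
-- and A, B contain falling stars of sizes k + 1, l + 1 with |A| ≤ 2^k, |B| ≤ 2^l, put any
-- vertex of the other part on top of the larger star: by symmetry of φ it has colour γ
-- to every star vertex, so the star grows by one while |S| ≤ 2^(max k l + 1).

open import Defs
open import Data.Nat using (ℕ; suc; _≤_; _<_; _%_; _+_; _^_; _≤?_)
import Data.Nat.Properties as ℕ
open import Data.Nat.Logarithm using (⌈log₂_⌉; ⌈log₂⌉-mono-≤; ⌈log₂2^n⌉≡n)
open import Data.List using (List; length; []; _∷_; _++_)
open import Data.List.Properties using (length-++)
open import Data.List.Relation.Unary.All using (All)
import Data.List.Relation.Unary.All as All
import Data.List.Relation.Unary.All.Properties as All
open import Data.List.Relation.Unary.Any using (here; there)
open import Data.List.Relation.Unary.AllPairs using ([]; _∷_)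
open import Data.List.Relation.Unary.Unique.Propositional using (Unique)
open import Data.List.Relation.Binary.Disjoint.Propositional using (Disjoint)
open import Data.List.Relation.Binary.Subset.Propositional using (_⊆_)
open import Data.List.Membership.Propositional using (_∈_; _∉_)
open import Data.List.Membership.Propositional.Properties using (∈-++⁺ˡ; ∈-++⁺ʳ)
open import Data.List.Relation.Binary.Permutation.Propositional using (_↭_; ↭-sym; ↭-trans; ↭⇒↭ₛ)
open import Data.List.Relation.Binary.Permutation.Propositional.Properties using (∈-resp-↭; ↭-length; ++-comm)
import Data.List.Relation.Binary.Permutation.Setoid.Properties as Permutationₛ
open import Data.Fin using (Fin; zero; inject₁)
import Data.Fin as Fin
import Data.Fin.Properties as Fin
open import Data.Fin.Relation.Unary.Top using (view; ‵fromℕ; ‵inject₁)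
open import Data.Vec using (Vec; []; _∷_; lookup)
open import Data.Maybe using (just; nothing)
open import Data.Product using (∃; _×_; _,_; proj₁)
open import Relation.Nullary using (yes; no; contradiction)
open import Relation.Binary using (IsStrictTotalOrder; tri<; tri≈; tri>)
open import Relation.Binary.PropositionalEquality
  using (_≡_; _≢_; refl; sym; trans; cong; subst; subst₂; setoid)

module _ {A : Set} where

  Unique-resp-↭ : ∀ {xs ys : List A} → xs ↭ ys → Unique xs → Unique ys
  Unique-resp-↭ xs↭ys = Permutationₛ.Unique-resp-↭ (setoid A) (↭⇒↭ₛ xs↭ys)

  Unique-++⁻ˡ : ∀ xs {ys : List A} → Unique (xs ++ ys) → Unique xs
  Unique-++⁻ˡ []       _              = []
  Unique-++⁻ˡ (x ∷ xs) (x∉ ∷ unique) = All.++⁻ˡ xs x∉ ∷ Unique-++⁻ˡ xs unique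

  Unique-++⁻ʳ : ∀ xs {ys : List A} → Unique (xs ++ ys) → Unique ys
  Unique-++⁻ʳ []       unique       = unique
  Unique-++⁻ʳ (x ∷ xs) (_ ∷ unique) = Unique-++⁻ʳ xs unique

  Unique-++⇒Disjoint : ∀ xs {ys : List A} → Unique (xs ++ ys) → Disjoint xs ys
  Unique-++⇒Disjoint (x ∷ xs) (x∉ ∷ _) (here refl , y∈ys) =
    All.lookup (All.++⁻ʳ xs x∉) y∈ys refl
  Unique-++⇒Disjoint (x ∷ xs) (_ ∷ unique) (there y∈xs , y∈ys) =
    Unique-++⇒Disjoint xs unique (y∈xs , y∈ys)

  _∷ʳ_ : ∀ {t} → (Fin t → A) → A → Fin (suc t) → A
  (s ∷ʳ x) i with view i
  ... | ‵fromℕ      = x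
  ... | ‵inject₁ j = s j

m+n≤2^[1+k] : ∀ {m n k l} → m ≤ 2 ^ k → n ≤ 2 ^ l → l ≤ k → m + n ≤ 2 ^ suc k
m+n≤2^[1+k] {m} {n} {k} m≤2^k n≤2^l l≤k =
  subst (m + n ≤_) (cong (2 ^ k +_) (sym (ℕ.+-identityʳ (2 ^ k))))
    (ℕ.+-mono-≤ m≤2^k (ℕ.≤-trans n≤2^l (ℕ.^-monoʳ-≤ 2 l≤k)))

⌈log₂⌉≤ : ∀ {n k} → n ≤ 2 ^ k → ⌈log₂ n ⌉ ≤ k
⌈log₂⌉≤ {n} {k} n≤2^k = subst (⌈log₂ n ⌉ ≤_) (⌈log₂2^n⌉≡n k) (⌈log₂⌉-mono-≤ n≤2^k)

module _ (𝔽 : FiniteField) (d : ℕ) where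
  open FiniteField 𝔽 using (Carrier; isSTO)
  open WithField 𝔽 d

  firstDiff-sym : ∀ {n} (x y : Vec Carrier n) → firstDiff x y ≡ firstDiff y x
  firstDiff-sym [] [] = refl
  firstDiff-sym (a ∷ xs) (b ∷ ys) with a ≟F b | b ≟F a
  ... | yes a≡b | no  b≢a = contradiction (sym a≡b) b≢a
  ... | no  a≢b | yes b≡a = contradiction (sym b≡a) a≢b
  ... | no  _   | no  _   = refl
  ... | yes _   | yes _
    with firstDiff xs ys | firstDiff ys xs | firstDiff-sym xs ys
  ...   | nothing | .nothing | refl = refl
  ...   | just i  | .(just i) | refl = refl

  φ-sym : ∀ x y → φ x y ≡ φ y x
  φ-sym x y with firstDiff x y | firstDiff y x | firstDiff-sym x y
  ... | nothing | .nothing | refl = refl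
  ... | just i  | .(just i) | refl
    with IsStrictTotalOrder.compare isSTO (lookup x i) (lookup y i)
       | IsStrictTotalOrder.compare isSTO (lookup y i) (lookup x i)
  ...   | tri< _ _ _  | tri> _ _ _  = refl
  ...   | tri≈ _ _ _  | tri≈ _ _ _  = refl
  ...   | tri> _ _ _  | tri< _ _ _  = refl
  ...   | tri< _ _ y≮x | tri< y<x _ _ = contradiction y<x y≮x
  ...   | tri< _ x≢y _ | tri≈ _ y≡x _ = contradiction (sym y≡x) x≢y
  ...   | tri≈ _ x≡y _ | tri< _ y≢x _ = contradiction (sym x≡y) y≢x
  ...   | tri≈ _ x≡y _ | tri> _ y≢x _ = contradiction (sym x≡y) y≢x
  ...   | tri> _ x≢y _ | tri≈ _ y≡x _ = contradiction (sym y≡x) x≢y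
  ...   | tri> x≮y _ _ | tri> _ _ x<y = contradiction x<y x≮y

  HasFallingStar-∷ʳ : ∀ {X S : List V} {t x c} → HasFallingStar X t → X ⊆ S →
                      x ∈ S → x ∉ X → (∀ {y} → y ∈ X → φ x y ≡ c) →
                      HasFallingStar S (suc t)
  HasFallingStar-∷ʳ {X} {S} {t} {x} {c} (s , s-inj , s∈X , α , s-falls) X⊆S x∈S x∉X x-col =
    s ∷ʳ x , injective , member , α ∷ʳ c , falls
    where
    injective : ∀ i j → (s ∷ʳ x) i ≡ (s ∷ʳ x) j → i ≡ j
    injective i j eq with view i | view j
    ... | ‵fromℕ      | ‵fromℕ      = refl
    ... | ‵fromℕ      | ‵inject₁ j′ = contradiction (subst (_∈ X) (sym eq) (s∈X j′)) x∉X
    ... | ‵inject₁ i′ | ‵fromℕ      = contradiction (subst (_∈ X) eq (s∈X i′)) x∉X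
    ... | ‵inject₁ i′ | ‵inject₁ j′ = cong inject₁ (s-inj i′ j′ eq)

    member : ∀ i → (s ∷ʳ x) i ∈ S
    member i with view i
    ... | ‵fromℕ      = x∈S
    ... | ‵inject₁ i′ = X⊆S (s∈X i′)

    falls : ∀ i j → j Fin.< i → φ ((s ∷ʳ x) i) ((s ∷ʳ x) j) ≡ (α ∷ʳ c) i
    falls i j j<i with view i | view j
    ... | ‵fromℕ      | ‵fromℕ      = contradiction j<i (ℕ.<-irrefl refl)
    ... | ‵fromℕ      | ‵inject₁ j′ = x-col (s∈X j′)
    ... | ‵inject₁ i′ | ‵fromℕ      = contradiction (Fin.≤fromℕ (inject₁ i′)) (ℕ.<⇒≱ j<i)
    ... | ‵inject₁ i′ | ‵inject₁ j′ =
      s-falls i′ j′ (subst₂ _<_ (Fin.toℕ-inject₁ j′) (Fin.toℕ-inject₁ i′) j<i)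

  LogStar : List V → ℕ → Set
  LogStar S k = length S ≤ 2 ^ k × HasFallingStar S (suc k)

  LogStar-[_] : ∀ x → LogStar (x ∷ []) 0
  LogStar-[ x ] = ℕ.≤-refl , (λ _ → x) , (λ { zero zero _ → refl }) , (λ _ → here refl) ,
                  (λ _ → φ x x) , (λ _ _ _ → refl)

  LogStar-join : ∀ {S X Y : List V} {k l γ} → S ↭ X ++ Y → Unique (X ++ Y) → Y ≢ [] →
                 (∀ {x y} → x ∈ X → y ∈ Y → φ y x ≡ γ) →
                 LogStar X k → length Y ≤ 2 ^ l → l ≤ k → LogStar S (suc k)
  LogStar-join {Y = []} _ _ Y≢[] = contradiction refl Y≢[]
  LogStar-join {S} {X} {Y@(y ∷ _)} {k} S↭XY unique _ cross (|X|≤2^k , X-star) |Y|≤2^l l≤k =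
    |S|≤2^[1+k] , HasFallingStar-∷ʳ X-star X⊆S (S-of-XY (∈-++⁺ʳ X (here refl))) y∉X
                      (λ x∈X → cross x∈X (here refl))
    where
    S-of-XY : ∀ {z} → z ∈ X ++ Y → z ∈ S
    S-of-XY = ∈-resp-↭ (↭-sym S↭XY)

    X⊆S : X ⊆ S
    X⊆S z∈X = S-of-XY (∈-++⁺ˡ z∈X)

    y∉X : y ∉ X
    y∉X y∈X = Unique-++⇒Disjoint X unique (y∈X , here refl)

    |S|≤2^[1+k] : length S ≤ 2 ^ suc k
    |S|≤2^[1+k] = subst (_≤ 2 ^ suc k) (sym (trans (↭-length S↭XY) (length-++ X)))
                    (m+n≤2^[1+k] |X|≤2^k |Y|≤2^l l≤k)

  Leftover⇒LogStar : ∀ {S} → Leftover S → Unique S → ∃ (LogStar S)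
  Leftover⇒LogStar (single x) _ = 0 , LogStar-[ x ]
  Leftover⇒LogStar {S} (split A B S↭AB A≢[] B≢[] A-left B-left _ _ cross _ _) S-unique =
    larger (Leftover⇒LogStar A-left (Unique-++⁻ˡ A AB-unique))
           (Leftover⇒LogStar B-left (Unique-++⁻ʳ A AB-unique))
    where
    AB-unique : Unique (A ++ B)
    AB-unique = Unique-resp-↭ S↭AB S-unique

    S↭BA : S ↭ B ++ A
    S↭BA = ↭-trans S↭AB (++-comm A B)

    larger : ∃ (LogStar A) → ∃ (LogStar B) → ∃ (LogStar S)
    larger (k , A-star) (l , B-star) with l ≤? k
    ... | yes l≤k = suc k , LogStar-join S↭AB AB-unique B≢[]
                              (λ {a} {b} a∈A b∈B → trans (φ-sym b a) (cross a b a∈A b∈B))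
                              A-star (proj₁ B-star) l≤k
    ... | no  l≰k = suc l , LogStar-join S↭BA (Unique-resp-↭ S↭BA S-unique) A≢[]
                              (λ {b} {a} b∈B a∈A → cross a b a∈A b∈B)
                              B-star (proj₁ A-star) (ℕ.≰⇒≥ l≰k)

lemma9 : (𝔽 : FiniteField) → FiniteField.q 𝔽 % 2 ≡ 1 →
         (d : ℕ) → 1 ≤ d → (p : ℕ) → 1 ≤ p →
         (S : List (WithField.V 𝔽 d)) →
         Unique S → All (WithField.Nonzero 𝔽 d) S → length S ≡ p →
         WithField.Leftover 𝔽 d S →
         WithField.FS≥ 𝔽 d S (⌈log₂ p ⌉ + 1)
lemma9 𝔽 _ d _ _ _ S S-unique _ refl S-left with Leftover⇒LogStar 𝔽 d S-left S-unique
... | k , |S|≤2^k , star =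
  suc k , subst (⌈log₂ length S ⌉ + 1 ≤_) (ℕ.+-comm k 1) (ℕ.+-monoˡ-≤ 1 (⌈log₂⌉≤ |S|≤2^k)) , star
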